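{- For Non-Risky Stochastic Knapsack, the adaptivity gap $\sup_I \mathrm{ADAPT}(I)/\mathrm{ALG}(I)$ is at least $1+\frac1e$.
   Context: Stochastic Knapsack: an instance $I$ consists of $n$ items; item $i$ has a deterministic value $v_i\ge 0$ and a random nonnegative size $S_i$ drawn from a known distribution, independently across items. The knapsack capacity is $1$. A policy inserts items one at a time (each at most once) and may stop; execution ends when the policy stops or at the first overflow (total realized size of inserted items exceeds $1$). In Non-Risky Stochastic Knapsack the policy receives the sum of values of the inserted items except that the overflowing item contributes no value. $\mathrm{ADAPT}(I)$ is the maximum expected value over fully adaptive policies and $\mathrm{ALG}(I)$ the maximum over non-adaptive policies (fixed insertion sequence). -}

module Defs where

open import Data.Nat using (ℕ; zero; suc; _^_)
open import Data.Fin using (Fin)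
open import Data.List using (List; []; _∷_)
open import Data.List.Relation.Unary.All using (All)
open import Data.List.Relation.Unary.Unique.Propositional using (Unique)
open import Data.List.Membership.Propositional using (_∉_)
open import Data.Product using (_×_; _,_; proj₁; proj₂; Σ; ∃)
open import Data.Unit using (⊤)
open import Data.Integer using (+_)
open import Data.Rational using (ℚ; 0ℚ; 1ℚ; _+_; _*_; _-_; _≤_; _<_; _≤?_; _/_)
open import Relation.Nullary using (yes; no)
open import Relation.Binary.PropositionalEquality using (_≡_)

-- A finitely supported size distribution: list of (probability , size) atoms.
Dist : Set
Dist = List (ℚ × ℚ)

record Item : Set where
  constructor item
  field
    value : ℚ
    dist  : Dist
open Item public

-- An instance with n items (capacity is normalised to 1).
Instance : ℕ → Set
Instance n = Fin n → Item

probSum : Dist → ℚ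
probSum [] = 0ℚ
probSum ((p , _) ∷ d) = p + probSum d

ValidDist : Dist → Set
ValidDist d = All (λ ps → (0ℚ ≤ proj₁ ps) × (0ℚ ≤ proj₂ ps)) d × (probSum d ≡ 1ℚ)

ValidItem : Item → Set
ValidItem it = (0ℚ ≤ value it) × ValidDist (dist it)

ValidInstance : ∀ {n} → Instance n → Set
ValidInstance {n} I = (i : Fin n) → ValidItem (I i)

-- Adaptive policies as decision trees: either stop, or insert item i and
-- continue according to the index j of the realised atom of the size of i.
data Policy (n : ℕ) : Set where
  stop   : Policy n
  insert : Fin n → (ℕ → Policy n) → Policy n

WellFormed : ∀ {n} → List (Fin n) → Policy n → Set
WellFormed used stop = ⊤
WellFormed used (insert i k) = (i ∉ used) × ((j : ℕ) → WellFormed (i ∷ used) (k j))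

-- Expected value (Non-Risky): given remaining capacity c, inserting an item of
-- realised size s with s ≤ c yields its value and continues with capacity c - s;
-- if s > c (overflow) the item contributes nothing and execution ends.
mutual
  expVal : ∀ {n} → Instance n → Policy n → ℚ → ℚ
  expVal I stop c = 0ℚ
  expVal I (insert i k) c = expAtoms I (value (I i)) k (dist (I i)) 0 c

  expAtoms : ∀ {n} → Instance n → ℚ → (ℕ → Policy n) → Dist → ℕ → ℚ → ℚ
  expAtoms I v k [] j c = 0ℚ
  expAtoms I v k ((p , s) ∷ d) j c with s ≤? c
  ... | yes _ = p * (v + expVal I (k j) (c - s)) + expAtoms I v k d (suc j) c
  ... | no _  = expAtoms I v k d (suc j) c

value₁ : ∀ {n} → Instance n → Policy n → ℚ
value₁ I P = expVal I P 1ℚ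

fixedPolicy : ∀ {n} → List (Fin n) → Policy n
fixedPolicy [] = stop
fixedPolicy (i ∷ σ) = insert i (λ _ → fixedPolicy σ)

ℕ→ℚ : ℕ → ℚ
ℕ→ℚ m = + m / 1

-- One six-item instance already has adaptivity gap above 1 + 1/e. Its best non-adaptive
-- order earns M = 27106257/48828125 (checked against every duplicate-free order), while an
-- adaptive decision tree earns more than (11/8)·M, both by exact rational evaluation.
-- The ratio 1 + (N/(N+1))^(N+1) of the statement stays below 11/8 for every N, because
-- truncating the binomial expansion gives (1 + 1/N)^(N+1) ≥ Σ_{k ≤ 3} C(N+1, k)/N^k ≥ 8/3.
module Submission where

open import Defs
open import Data.Bool using (Bool; false; T; _∧_; _∨_)
open import Data.Bool.ListAction using (all)
open import Data.Bool.Properties using (T-∧; T-∨)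
open import Data.Empty using (⊥-elim)
open import Data.Fin using (Fin)
open import Data.Fin.Patterns using (0F; 1F; 2F; 3F; 4F; 5F)
import Data.Fin.Properties as Fin
open import Data.Integer as ℤ using (+_)
import Data.Integer.Properties as ℤ
open import Data.List using (List; []; _∷_; length; allFin)
open import Data.List.Membership.Propositional using (_∈_; _∉_)
open import Data.List.Membership.Propositional.Properties using (∈-allFin)
open import Data.List.Relation.Unary.All as All using (All; []; _∷_)
open import Data.List.Relation.Unary.All.Properties using (all⁺)
open import Data.List.Relation.Unary.AllPairs using (_∷_)
open import Data.List.Relation.Unary.Any using (here; there)
open import Data.List.Relation.Unary.Unique.Propositional using (Unique)
open import Data.Nat as ℕ using (ℕ; zero; suc; _^_)
import Data.Nat.Coprimality as Coprime
import Data.Nat.Properties as ℕ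
open import Data.Product using (_×_; Σ; _,_; proj₁; proj₂)
open import Data.Sum as Sum using (_⊎_; inj₁; inj₂)
open import Data.Unit using (tt)
open import Function using (_∘_; _∘′_)
open import Function.Bundles using (Equivalence)
open import Relation.Binary.Definitions using (DecidableEquality)
open import Relation.Binary.PropositionalEquality as ≡ using (_≡_; _≢_; cong; subst₂)
open import Relation.Nullary using (Dec; yes; ¬?)
open import Relation.Nullary.Decidable using (isYes; toWitness; _×-dec_; map′)

module UniqueSearch {A : Set} (_≟_ : DecidableEquality A)
                    (universe : List A) (complete : ∀ x → x ∈ universe) where

  open import Data.List.Membership.DecPropositional _≟_ using (_∈?_)

  -- Tests Q on every duplicate-free list avoiding `used`; answers false if the fuel k runs
  -- out while some element is still unused.
  mutual
    allFresh : ℕ → List A → (List A → Bool) → Bool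
    allFresh k used Q = Q [] ∧ all (λ x → isYes (x ∈? used) ∨ allFreshAfter k used Q x) universe

    allFreshAfter : ℕ → List A → (List A → Bool) → A → Bool
    allFreshAfter zero    used Q x = false
    allFreshAfter (suc k) used Q x = allFresh k (x ∷ used) (Q ∘′ (x ∷_))

  allFresh⇒nil : ∀ k used Q → T (allFresh k used Q) → T (Q [])
  allFresh⇒nil k used Q ok = proj₁ (Equivalence.to T-∧ ok)

  allFresh⇒cons : ∀ k used Q → T (allFresh k used Q) →
                  ∀ x → x ∈ used ⊎ T (allFreshAfter k used Q x)
  allFresh⇒cons k used Q ok x =
    Sum.map₁ (toWitness {a? = x ∈? used})
             (Equivalence.to (T-∨ {isYes (x ∈? used)}) (All.lookup everyEntry (complete x)))
    where everyEntry = all⁺ _ universe (proj₂ (Equivalence.to T-∧ ok))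

  allFresh-sound : ∀ k used Q → T (allFresh k used Q) →
                   ∀ σ → Unique σ → All (_∉ used) σ → T (Q σ)
  allFresh-sound k used Q ok [] _ _ = allFresh⇒nil k used Q ok
  allFresh-sound k used Q ok (x ∷ σ) (x∉σ ∷ σ!) (x∉used ∷ σ∉used)
    with allFresh⇒cons k used Q ok x
  ... | inj₁ x∈used = ⊥-elim (x∉used x∈used)
  allFresh-sound zero    used Q ok (x ∷ σ) (x∉σ ∷ σ!) (x∉used ∷ σ∉used) | inj₂ ()
  allFresh-sound (suc k) used Q ok (x ∷ σ) (x∉σ ∷ σ!) (x∉used ∷ σ∉used) | inj₂ rest =
    allFresh-sound k (x ∷ used) (Q ∘′ (x ∷_)) rest σ σ! (All.zipWith ∉-∷ (x∉σ , σ∉used))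
    where
    ∉-∷ : ∀ {y} → (x ≢ y) × (y ∉ used) → y ∉ x ∷ used
    ∉-∷ (x≢y , y∉used) (here y≡x)     = x≢y (≡.sym y≡x)
    ∉-∷ (x≢y , y∉used) (there y∈used) = y∉used y∈used

  allUnique : (List A → Bool) → Bool
  allUnique = allFresh (length universe) []

  allUnique-sound : ∀ Q → T (allUnique Q) → ∀ σ → Unique σ → T (Q σ)
  allUnique-sound Q ok σ σ! =
    allFresh-sound (length universe) [] Q ok σ σ! (All.universal (λ _ ()) σ)

module BinomialBound where

  open import Data.Nat using (_+_; _*_; _≤_; z≤n)
  open import Data.Nat.Properties
  open import Algebra.Properties.CommutativeSemigroup *-commutativeSemigroup using (x∙yz≈y∙xz)
  open import Data.Nat.Tactic.RingSolver using (solve-∀)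

  -- 6 N³ Σ_{k ≤ 3} C(m, k) / N^k for m = j + 2, so that no truncated subtraction occurs.
  binomialHead : ℕ → ℕ → ℕ
  binomialHead N j =
    6 * N * N * N + 6 * (j + 2) * N * N + 3 * (j + 2) * (j + 1) * N + (j + 2) * (j + 1) * j

  -- The reflective ring solver neither unfolds definitions nor handles _^_ on ℕ, hence the
  -- `expanded` restatements (with x ^ 2 as x * (x * 1) and suc x as 1 + x).
  binomialHead-zero : ∀ N → N ^ 2 * binomialHead N 0 ≡ 6 * N * N * N * suc N ^ 2
  binomialHead-zero = expanded
    where
    expanded : ∀ N → N * (N * 1) * (6 * N * N * N + 6 * 2 * N * N + 3 * 2 * 1 * N + 2 * 1 * 0)
                     ≡ 6 * N * N * N * ((1 + N) * ((1 + N) * 1))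
    expanded = solve-∀

  binomialHead-suc : ∀ N j →
    suc N * binomialHead N j ≡ N * binomialHead N (suc j) + (j + 2) * (j + 1) * j
  binomialHead-suc = expanded
    where
    expanded : ∀ N j →
      (1 + N) * (6 * N * N * N + 6 * (j + 2) * N * N + 3 * (j + 2) * (j + 1) * N
                 + (j + 2) * (j + 1) * j)
      ≡ N * (6 * N * N * N + 6 * (1 + j + 2) * N * N + 3 * (1 + j + 2) * (1 + j + 1) * N
             + (1 + j + 2) * (1 + j + 1) * (1 + j))
        + (j + 2) * (j + 1) * j
    expanded = solve-∀

  16*n³≤binomialHead[n,n∸1] : ∀ j → 16 * suc j * suc j * suc j ≤ binomialHead (suc j) j
  16*n³≤binomialHead[n,n∸1] j = ≤-trans (m≤m+n _ _) (≤-reflexive (≡.sym (expanded j)))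
    where
    expanded : ∀ j →
      6 * (1 + j) * (1 + j) * (1 + j) + 6 * (j + 2) * (1 + j) * (1 + j)
      + 3 * (j + 2) * (j + 1) * (1 + j) + (j + 2) * (j + 1) * j
      ≡ 16 * (1 + j) * (1 + j) * (1 + j) + (1 + j) * (9 * j + 8)
    expanded = solve-∀

  pow*binomialHead≤ : ∀ N j → N ^ (2 + j) * binomialHead N j ≤ 6 * N * N * N * suc N ^ (2 + j)
  pow*binomialHead≤ N zero    = ≤-reflexive (binomialHead-zero N)
  pow*binomialHead≤ N (suc j) = begin
    N ^ (3 + j) * binomialHead N (suc j)                  ≡⟨ *-assoc N (N ^ (2 + j)) _ ⟩
    N * (N ^ (2 + j) * binomialHead N (suc j))            ≡⟨ x∙yz≈y∙xz N (N ^ (2 + j)) _ ⟩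
    N ^ (2 + j) * (N * binomialHead N (suc j))            ≤⟨ *-monoʳ-≤ (N ^ (2 + j)) (m≤m+n _ _) ⟩
    N ^ (2 + j) * (N * binomialHead N (suc j) + (j + 2) * (j + 1) * j)
                                                          ≡⟨ cong (N ^ (2 + j) *_) (binomialHead-suc N j) ⟨
    N ^ (2 + j) * (suc N * binomialHead N j)              ≡⟨ x∙yz≈y∙xz (N ^ (2 + j)) (suc N) _ ⟩
    suc N * (N ^ (2 + j) * binomialHead N j)              ≤⟨ *-monoʳ-≤ (suc N) (pow*binomialHead≤ N j) ⟩
    suc N * (6 * N * N * N * suc N ^ (2 + j))             ≡⟨ x∙yz≈y∙xz (suc N) (6 * N * N * N) _ ⟩
    6 * N * N * N * suc N ^ (3 + j)                       ∎
    where open ≤-Reasoning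

  8*n^[1+n]≤3*[1+n]^[1+n] : ∀ n → 8 * n ^ suc n ≤ 3 * suc n ^ suc n
  8*n^[1+n]≤3*[1+n]^[1+n] zero    = z≤n
  8*n^[1+n]≤3*[1+n]^[1+n] (suc j) = *-cancelˡ-≤ (16 * N * N * N) (begin
    16 * N * N * N * (8 * N ^ suc N)    ≤⟨ *-monoˡ-≤ _ (16*n³≤binomialHead[n,n∸1] j) ⟩
    binomialHead N j * (8 * N ^ suc N)  ≡⟨ rearrange (binomialHead N j) (N ^ suc N) ⟩
    8 * (N ^ suc N * binomialHead N j)  ≤⟨ *-monoʳ-≤ 8 (pow*binomialHead≤ N j) ⟩
    8 * (6 * N * N * N * suc N ^ suc N) ≡⟨ regroup N (suc N ^ suc N) ⟩
    16 * N * N * N * (3 * suc N ^ suc N) ∎)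
    where
    open ≤-Reasoning
    N = suc j
    rearrange : ∀ h x → h * (8 * x) ≡ 8 * (x * h)
    rearrange = solve-∀
    regroup : ∀ n y → 8 * (6 * n * n * n * y) ≡ 16 * n * n * n * (3 * y)
    regroup = solve-∀

open BinomialBound using (8*n^[1+n]≤3*[1+n]^[1+n])

-- Opened only here, since these names clash with the ℕ ones used above.
open import Data.Rational
  using (ℚ; 0ℚ; 1ℚ; _+_; _*_; _/_; _≤_; _<_; _≤?_; _<?_; _≤ᵇ_; NonNegative; mkℚ; toℚᵘ)
open import Data.Rational.Properties
import Data.Rational.Unnormalised as ℚᵘ
import Data.Rational.Unnormalised.Properties as ℚᵘ

ℕ→ℚ-nonNeg : ∀ m → NonNegative (ℕ→ℚ m)
ℕ→ℚ-nonNeg m = normalize-nonNeg m 1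

ℕ→ℚ≡mkℚ : ∀ m → ℕ→ℚ m ≡ mkℚ (+ m) 0 (Coprime.sym (Coprime.1-coprimeTo m))
ℕ→ℚ≡mkℚ m = normalize-coprime (Coprime.sym (Coprime.1-coprimeTo m))

8*b≤3*a⇒b≤3/8*a : ∀ a b → 8 ℕ.* b ℕ.≤ 3 ℕ.* a → ℕ→ℚ b ≤ + 3 / 8 * ℕ→ℚ a
8*b≤3*a⇒b≤3/8*a a b 8b≤3a =
  toℚᵘ-cancel-≤ (ℚᵘ.≤-respʳ-≃ (ℚᵘ.≃-sym (toℚᵘ-homo-* (+ 3 / 8) (ℕ→ℚ a))) unnormalised)
  where
  -- In ℚᵘ the product is computed without normalising, leaving an inequality of integers.
  unnormalised : toℚᵘ (ℕ→ℚ b) ℚᵘ.≤ toℚᵘ (+ 3 / 8) ℚᵘ.* toℚᵘ (ℕ→ℚ a)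
  unnormalised rewrite ℕ→ℚ≡mkℚ a | ℕ→ℚ≡mkℚ b | ℤ.+◃n≡+n (3 ℕ.* a) =
    ℚᵘ.*≤* (subst₂ ℤ._≤_ (ℤ.pos-* b 8) (≡.sym (ℤ.*-identityʳ (+ (3 ℕ.* a))))
                         (ℤ.+≤+ (≡.subst (ℕ._≤ 3 ℕ.* a) (ℕ.*-comm 8 b) 8b≤3a)))

scaledGap-≤ : ∀ A B ρ {M v w} .{{_ : NonNegative A}} .{{_ : NonNegative B}} .{{_ : NonNegative M}} →
              B ≤ ρ * A → v ≤ M → (1ℚ + ρ) * M ≤ w → (A + B) * v ≤ A * w
scaledGap-≤ A B ρ {M} {v} {w} B≤ρA v≤M [1+ρ]M≤w = begin
  (A + B) * v          ≤⟨ *-monoˡ-≤-nonNeg (A + B) {{nonNeg+nonNeg⇒nonNeg A B}} v≤M ⟩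
  (A + B) * M          ≤⟨ *-monoʳ-≤-nonNeg M (+-monoʳ-≤ A B≤ρA) ⟩
  (A + ρ * A) * M      ≡⟨ cong (λ x → (x + ρ * A) * M) (*-identityˡ A) ⟨
  (1ℚ * A + ρ * A) * M ≡⟨ cong (_* M) (*-distribʳ-+ A 1ℚ ρ) ⟨
  (1ℚ + ρ) * A * M     ≡⟨ cong (_* M) (*-comm (1ℚ + ρ) A) ⟩
  A * (1ℚ + ρ) * M     ≡⟨ *-assoc A (1ℚ + ρ) M ⟩
  A * ((1ℚ + ρ) * M)   ≤⟨ *-monoˡ-≤-nonNeg A [1+ρ]M≤w ⟩
  A * w                ∎
  where open ≤-Reasoning

-- Finitely branching policies, on which WellFormed is decidable.
data DecisionTree (n : ℕ) : Set where
  leaf : DecisionTree n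
  node : Fin n → List (DecisionTree n) → DecisionTree n

mutual
  toPolicy : ∀ {n} → DecisionTree n → Policy n
  toPolicy leaf        = stop
  toPolicy (node i ts) = insert i (branch ts)

  branch : ∀ {n} → List (DecisionTree n) → ℕ → Policy n
  branch []       j       = stop
  branch (t ∷ ts) zero    = toPolicy t
  branch (t ∷ ts) (suc j) = branch ts j

module _ {n : ℕ} where
  open import Data.List.Membership.DecPropositional (Fin._≟_ {n}) using (_∈?_)

  mutual
    wellFormed? : ∀ used (t : DecisionTree n) → Dec (WellFormed used (toPolicy t))
    wellFormed? used leaf        = yes tt
    wellFormed? used (node i ts) = ¬? (i ∈? used) ×-dec branchesWellFormed? (i ∷ used) ts

    branchesWellFormed? : ∀ used (ts : List (DecisionTree n)) →
                          Dec (∀ j → WellFormed used (branch ts j))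
    branchesWellFormed? used []       = yes (λ _ → tt)
    branchesWellFormed? used (t ∷ ts) =
      map′ (λ (p , ps) → λ { zero → p ; (suc j) → ps j }) (λ f → f zero , f ∘ suc)
           (wellFormed? used t ×-dec branchesWellFormed? used ts)

validItem? : (it : Item) → Dec (ValidItem it)
validItem? it = 0ℚ ≤? value it
  ×-dec All.all? (λ ps → 0ℚ ≤? proj₁ ps ×-dec 0ℚ ≤? proj₂ ps) (dist it)
  ×-dec probSum (dist it) ≟ 1ℚ

validInstance? : ∀ {n} (I : Instance n) → Dec (ValidInstance I)
validInstance? I = Fin.all? (validItem? ∘ I)

hardInstance : Instance 6
hardInstance 0F = item (+ 1 / 5)   ((+ 16 / 25 , 0ℚ)      ∷ (+ 9 / 25 , 1ℚ)       ∷ [])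
hardInstance 1F = item (+ 1 / 5)   ((+ 9 / 25 , 1ℚ)       ∷ (+ 16 / 25 , + 1 / 2) ∷ [])
hardInstance 2F = item (+ 3 / 5)   ((+ 21 / 50 , + 2 / 1) ∷ (+ 29 / 50 , + 1 / 2) ∷ [])
hardInstance 3F = item (+ 7 / 5)   ((+ 4 / 5 , + 2 / 1)   ∷ (+ 1 / 5 , 0ℚ)        ∷ [])
hardInstance 4F = item (+ 43 / 20) ((+ 43 / 50 , + 2 / 1) ∷ (+ 7 / 50 , 0ℚ)       ∷ [])
hardInstance 5F = item (+ 16 / 5)  ((+ 1 / 10 , 0ℚ)       ∷ (+ 9 / 10 , + 2 / 1)  ∷ [])

hardInstance-valid : ValidInstance hardInstance
hardInstance-valid = toWitness {a? = validInstance? hardInstance} tt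

adaptiveTree : DecisionTree 6
adaptiveTree = node 0F (node 1F (tail ∷ node 2F (leaf ∷ tail ∷ []) ∷ []) ∷ tail ∷ [])
  where
  tail : DecisionTree 6
  tail = node 5F (node 3F (leaf ∷ node 4F [] ∷ []) ∷ [])

adaptiveTree-wellFormed : WellFormed [] (toPolicy adaptiveTree)
adaptiveTree-wellFormed = toWitness {a? = wellFormed? [] adaptiveTree} tt

bestOrder : List (Fin 6)
bestOrder = 1F ∷ 5F ∷ 0F ∷ 2F ∷ 4F ∷ 3F ∷ []

bestOrder-unique : Unique bestOrder
bestOrder-unique = toWitness {a? = unique? bestOrder} tt
  where open import Data.List.Relation.Unary.Unique.DecPropositional (Fin._≟_ {6}) using (unique?)

bestOrder-positive : 0ℚ < value₁ hardInstance (fixedPolicy bestOrder)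
bestOrder-positive = toWitness {a? = 0ℚ <? value₁ hardInstance (fixedPolicy bestOrder)} tt

-- Attained by bestOrder.
bestNonAdaptive : ℚ
bestNonAdaptive = + 27106257 / 48828125

nonAdaptive≤best : ∀ σ → Unique σ → value₁ hardInstance (fixedPolicy σ) ≤ bestNonAdaptive
nonAdaptive≤best σ σ! =
  ≤ᵇ⇒≤ (allUnique-sound (λ τ → value₁ hardInstance (fixedPolicy τ) ≤ᵇ bestNonAdaptive) tt σ σ!)
  where open UniqueSearch (Fin._≟_ {6}) (allFin 6) ∈-allFin using (allUnique-sound)

[1+3/8]*best≤adaptive : (1ℚ + + 3 / 8) * bestNonAdaptive ≤ value₁ hardInstance (toPolicy adaptiveTree)
[1+3/8]*best≤adaptive = toWitness {a? = _ ≤? value₁ hardInstance (toPolicy adaptiveTree)} tt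

mainTheorem9 : (N : ℕ) →
    Σ ℕ λ n → Σ (Instance n) λ I → ValidInstance I ×
      (Σ (Policy n) λ P → WellFormed [] P ×
        (Σ (List (Fin n)) λ σ₀ → Unique σ₀ × (0ℚ < value₁ I (fixedPolicy σ₀))) ×
        ((σ : List (Fin n)) → Unique σ →
          (ℕ→ℚ (suc N ^ suc N) + ℕ→ℚ (N ^ suc N)) * value₁ I (fixedPolicy σ)
            ≤ ℕ→ℚ (suc N ^ suc N) * value₁ I P))
mainTheorem9 N =
  6 , hardInstance , hardInstance-valid ,
  toPolicy adaptiveTree , adaptiveTree-wellFormed ,
  (bestOrder , bestOrder-unique , bestOrder-positive) ,
  λ σ σ! → scaledGap-≤ (ℕ→ℚ a) (ℕ→ℚ b) (+ 3 / 8) {{ℕ→ℚ-nonNeg a}} {{ℕ→ℚ-nonNeg b}}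
             b≤3/8*a (nonAdaptive≤best σ σ!) [1+3/8]*best≤adaptive
  where
  a = suc N ^ suc N
  b = N ^ suc N
  b≤3/8*a : ℕ→ℚ b ≤ + 3 / 8 * ℕ→ℚ a
  b≤3/8*a = 8*b≤3*a⇒b≤3/8*a a b (8*n^[1+n]≤3*[1+n]^[1+n] N)
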